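{- There exist infinitely many (finite, connected) regular nonbipartite nicely distance-balanced graphs which are not strongly distance-balanced.
   Context: For a connected graph and an edge $uv$, $W_{u,v}=\{x\mid d(x,u)<d(x,v)\}$, where $d$ is the path-length distance. A graph is nicely distance-balanced if there is a positive integer $\gamma$ with $|W_{u,v}|=|W_{v,u}|=\gamma$ for every edge $uv$. For an edge $uv$ let $D^i_j(u,v)=\{x\mid d(u,x)=i,\ d(v,x)=j\}$. A graph is strongly distance-balanced if $|D^i_{i-1}(u,v)|=|D^{i-1}_i(u,v)|$ for every $i\ge1$ and every edge $uv$. -}

module Defs where

open import Data.Nat using (ℕ; zero; suc; _+_; _<ᵇ_; _<_; _≥_)
open import Data.Bool using (Bool; true; false; _∧_; _∨_; if_then_else_; not)
open import Data.Fin using (Fin)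
open import Data.Fin.Properties using (_≟_)
open import Data.List using (List; foldr; allFin)
open import Data.Product using (Σ; ∃; _×_)
open import Relation.Nullary using (¬_)
open import Relation.Nullary.Decidable using (⌊_⌋)
open import Relation.Binary.PropositionalEquality using (_≡_; _≢_)

record Graph (n : ℕ) : Set where
  field
    adj    : Fin n → Fin n → Bool
    sym    : ∀ x y → adj x y ≡ adj y x
    irrefl : ∀ x → adj x x ≡ false
open Graph public

count : ∀ {n} → (Fin n → Bool) → ℕ
count {n} P = foldr (λ x acc → (if P x then 1 else 0) + acc) 0 (allFin n)

anyV : ∀ {n} → (Fin n → Bool) → Bool
anyV {n} P = foldr (λ x acc → P x ∨ acc) false (allFin n)

degree : ∀ {n} → Graph n → Fin n → ℕ
degree G x = count (λ y → adj G x y)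

data Walk {n} (G : Graph n) : Fin n → Fin n → Set where
  here : ∀ {x} → Walk G x x
  step : ∀ {x y z} → adj G x y ≡ true → Walk G y z → Walk G x z

Connected : ∀ {n} → Graph n → Set
Connected G = ∀ x y → Walk G x y

Regular : ∀ {n} → Graph n → Set
Regular G = ∃ λ k → ∀ x → degree G x ≡ k

Bipartite : ∀ {n} → Graph n → Set
Bipartite {n} G = Σ (Fin n → Bool) λ c → ∀ x y → adj G x y ≡ true → c x ≢ c y

reach : ∀ {n} → Graph n → ℕ → Fin n → Fin n → Bool
reach G zero    x y = ⌊ x ≟ y ⌋
reach G (suc k) x y = reach G k x y ∨ anyV (λ z → reach G k x z ∧ adj G z y)

search : (ℕ → Bool) → ℕ → ℕ → ℕ
search f zero       k = k
search f (suc fuel) k = if f k then k else search f fuel (suc k)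

-- path-length distance: the least k with a walk of length ≤ k from x to y.
-- (For a connected graph on n vertices this is attained for some k < n.)
dist : ∀ {n} → Graph n → Fin n → Fin n → ℕ
dist {n} G x y = search (λ k → reach G k x y) n 0

Wcard : ∀ {n} → Graph n → Fin n → Fin n → ℕ
Wcard G u v = count (λ x → dist G x u <ᵇ dist G x v)

Dcard : ∀ {n} → Graph n → Fin n → Fin n → ℕ → ℕ → ℕ
Dcard G u v i j = count (λ x → ⌊ dist G u x Data.Nat.≟ i ⌋ ∧ ⌊ dist G v x Data.Nat.≟ j ⌋)

NicelyDistanceBalanced : ∀ {n} → Graph n → Set
NicelyDistanceBalanced G =
  Σ ℕ λ γ → (γ ≥ 1) × (∀ u v → adj G u v ≡ true → (Wcard G u v ≡ γ) × (Wcard G v u ≡ γ))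

StronglyDistanceBalanced : ∀ {n} → Graph n → Set
StronglyDistanceBalanced G =
  ∀ u v → adj G u v ≡ true → ∀ i → i ≥ 1 → Dcard G u v i (i Data.Nat.∸ 1) ≡ Dcard G u v (i Data.Nat.∸ 1) i

{-# OPTIONS --safe #-}
-- The base graph H is a 4-regular graph on 30 vertices containing a 5-cycle, in which
-- every edge uv has |W_{u,v}| = 12, while the edge {0, 7} has |D³₂| = 5 ≠ 4 = |D²₃|.
-- Blowing up every vertex of H into m pairwise non-adjacent twins gives, for every m ≥ 1,
-- a graph with the same properties. Distances in the blow-up are those of H between
-- vertices over distinct vertices of H, and 2 between distinct twins. Hence the W-counts and
-- the D-counts with indices ≠ 1 of the blow-up are m times the corresponding counts in H
-- computed with this "twin distance" δ̂; the endpoints of the edge, the only vertices where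
-- the distance and δ̂ disagree, merely exchange their contributions to W.
module Submission where

open import Defs renaming (sym to adj-sym; irrefl to adj-irrefl)
open import Data.Bool using (Bool; true; false; T; _∧_; _∨_; not; if_then_else_)
open import Data.Bool.Properties as Bool using (T-≡; T-∨; T-∧; ¬-not; not-¬)
open import Data.Fin using (Fin; zero; suc; toℕ; _↑ˡ_; _↑ʳ_; combine; remainder; quotient; #_)
open import Data.Fin.Patterns using (0F; 1F; 2F)
open import Data.Fin.Permutation using (Permutation; transpose; _⟨$⟩ʳ_)
open import Data.Fin.Properties using (_≟_; all?; any?; splitAt-↑ʳ; remQuot-combine; nonZeroIndex)
open import Data.List using (List; []; _∷_; foldr; map; tabulate; allFin)
open import Data.List.Properties using (foldr-map; map-tabulate)
open import Data.Nat as ℕ using (ℕ; _≥_; zero; suc; _+_; _*_; _∸_; _≤_; _<ᵇ_; z≤n; s≤s; NonZero; >-nonZero⁻¹)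
open import Data.Nat.DivMod using (_mod_)
open import Data.Nat.Properties
  using (≤-refl; ≤-trans; ≤-reflexive; ≤-antisym; ≤∧≢⇒<; m≤n⇒m<n∨m≡n; m≤n⇒m≤1+n; +-identityʳ; +-suc; +-assoc; suc-injective;
         n≤1+n; m≤m*n; m≤n*m; *-mono-≤; *-cancelˡ-≡; +-0-commutativeMonoid)
open import Algebra.Properties.CommutativeMonoid.Sum +-0-commutativeMonoid using (sum; sum-permute)
open import Data.List.Membership.DecPropositional ℕ._≟_ using (_∈?_)
open import Data.Product using (Σ; ∃; _×_; _,_; proj₂)
open import Data.Sum using (_⊎_; inj₁; inj₂)
open import Data.Vec using (Vec; []; _∷_; lookup)
open import Function using (id; _∘_; _⇔_; mk⇔; Equivalence)
open import Relation.Nullary using (¬_; Dec; does; yes; no; ¬?)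
open import Relation.Nullary.Decidable using (⌊_⌋; isYes≗does; toWitness; fromWitness; dec-true; dec-false; _×-dec_; _⊎-dec_; _→-dec_)
open import Relation.Binary.PropositionalEquality using (_≡_; _≢_; refl; sym; trans; cong; cong₂; subst; subst₂; _≗_; module ≡-Reasoning)

open Equivalence using (to; from)

-- Counting and searching over Fin n

indicator : Bool → ℕ
indicator b = if b then 1 else 0

foldr-allFin-suc : ∀ {n} {B : Set} (f : Fin (suc n) → B → B) (e : B) →
                   foldr f e (allFin (suc n)) ≡ f zero (foldr (f ∘ suc) e (allFin n))
foldr-allFin-suc {n} f e = cong (f zero) (begin
  foldr f e (tabulate suc)                 ≡⟨ cong (foldr f e) (map-tabulate id suc) ⟨
  foldr f e (map suc (allFin n))           ≡⟨ foldr-map f suc e (allFin n) ⟩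
  foldr (f ∘ suc) e (allFin n)             ∎)
  where open ≡-Reasoning

count-suc : ∀ {n} (P : Fin (suc n) → Bool) → count P ≡ indicator (P zero) + count (P ∘ suc)
count-suc P = foldr-allFin-suc (λ x → indicator (P x) +_) 0

count≡sum : ∀ {n} (P : Fin n → Bool) → count P ≡ sum (indicator ∘ P)
count≡sum {zero}  P = refl
count≡sum {suc n} P = trans (count-suc P) (cong (indicator (P zero) +_) (count≡sum (P ∘ suc)))

count-cong : ∀ {n} {P Q : Fin n → Bool} → P ≗ Q → count P ≡ count Q
count-cong {zero}      P≗Q = refl
count-cong {suc n} {P} {Q} P≗Q = begin
  count P                                  ≡⟨ count-suc P ⟩
  indicator (P zero) + count (P ∘ suc)     ≡⟨ cong₂ _+_ (cong indicator (P≗Q zero)) (count-cong (P≗Q ∘ suc)) ⟩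
  indicator (Q zero) + count (Q ∘ suc)     ≡⟨ count-suc Q ⟨
  count Q                                  ∎
  where open ≡-Reasoning

count-permute : ∀ {n} (σ : Permutation n n) (P : Fin n → Bool) → count (P ∘ (σ ⟨$⟩ʳ_)) ≡ count P
count-permute σ P = begin
  count (P ∘ (σ ⟨$⟩ʳ_))             ≡⟨ count≡sum (P ∘ (σ ⟨$⟩ʳ_)) ⟩
  sum (indicator ∘ P ∘ (σ ⟨$⟩ʳ_))   ≡⟨ sum-permute (indicator ∘ P) σ ⟨
  sum (indicator ∘ P)               ≡⟨ count≡sum P ⟨
  count P                           ∎
  where open ≡-Reasoning

count-↑ : ∀ k {l} (P : Fin (k + l) → Bool) → count P ≡ count (P ∘ (_↑ˡ l)) + count (P ∘ (k ↑ʳ_))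
count-↑ zero    P = refl
count-↑ (suc k) {l} P = begin
  count P                                                                     ≡⟨ count-suc P ⟩
  indicator (P zero) + count (P ∘ suc)                                        ≡⟨ cong (indicator (P zero) +_) (count-↑ k (P ∘ suc)) ⟩
  indicator (P zero) + (count (P ∘ suc ∘ (_↑ˡ l)) + count (P ∘ (suc k ↑ʳ_)))  ≡⟨ +-assoc (indicator (P zero)) _ _ ⟨
  indicator (P zero) + count (P ∘ suc ∘ (_↑ˡ l)) + count (P ∘ (suc k ↑ʳ_))    ≡⟨ cong (_+ count (P ∘ (suc k ↑ʳ_))) (count-suc (P ∘ (_↑ˡ l))) ⟨
  count (P ∘ (_↑ˡ l)) + count (P ∘ (suc k ↑ʳ_))                               ∎
  where open ≡-Reasoning

remainder-↑ˡ : ∀ m {h} (a : Fin h) → remainder {suc m} h (a ↑ˡ (m * h)) ≡ a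
remainder-↑ˡ m a = cong proj₂ (remQuot-combine zero a)

remainder-↑ʳ : ∀ m {h} (x : Fin (m * h)) → remainder {suc m} h (h ↑ʳ x) ≡ remainder {m} h x
remainder-↑ʳ m {h} x rewrite splitAt-↑ʳ h (m * h) x = refl

count-∘remainder : ∀ m {h} (F : Fin h → Bool) → count (F ∘ remainder {m} h) ≡ m * count F
count-∘remainder zero        F = refl
count-∘remainder (suc m) {h} F = begin
  count (F ∘ remainder {suc m} h)                        ≡⟨ count-↑ h (F ∘ remainder {suc m} h) ⟩
  count (F ∘ remainder {suc m} h ∘ (_↑ˡ (m * h))) + count (F ∘ remainder {suc m} h ∘ (h ↑ʳ_))
    ≡⟨ cong₂ _+_ (count-cong (cong F ∘ remainder-↑ˡ m)) (count-cong (cong F ∘ remainder-↑ʳ m)) ⟩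
  count F + count (F ∘ remainder {m} h)                  ≡⟨ cong (count F +_) (count-∘remainder m F) ⟩
  count F + m * count F                                  ∎
  where open ≡-Reasoning

transpose-ˡ : ∀ {n} (i j : Fin n) → transpose i j ⟨$⟩ʳ i ≡ j
transpose-ˡ i j rewrite dec-true (i ≟ i) refl = refl

transpose-ʳ : ∀ {n} (i j : Fin n) → transpose i j ⟨$⟩ʳ j ≡ i
transpose-ʳ i j with j ≟ i
... | yes j≡i = j≡i
... | no  _   rewrite dec-true (j ≟ j) refl = refl

transpose-≢ : ∀ {n} {i j k : Fin n} → k ≢ i → k ≢ j → transpose i j ⟨$⟩ʳ k ≡ k
transpose-≢ {i = i} {j} {k} k≢i k≢j rewrite dec-false (k ≟ i) k≢i | dec-false (k ≟ j) k≢j = refl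

T-anyV : ∀ {n} (P : Fin n → Bool) → T (anyV P) ⇔ ∃ (T ∘ P)
T-anyV {zero}  P = mk⇔ (λ ()) (λ ())
T-anyV {suc n} P = mk⇔ to′ from′
  where
  anyV-suc : anyV P ≡ (P zero ∨ anyV (P ∘ suc))
  anyV-suc = foldr-allFin-suc (λ x → P x ∨_) false

  to′ : T (anyV P) → ∃ (T ∘ P)
  to′ t with to T-∨ (subst T anyV-suc t)
  ... | inj₁ p = zero , p
  ... | inj₂ q with to (T-anyV (P ∘ suc)) q
  ...   | i , p = suc i , p

  from′ : ∃ (T ∘ P) → T (anyV P)
  from′ (zero  , p) = subst T (sym anyV-suc) (from T-∨ (inj₁ p))
  from′ (suc i , p) = subst T (sym anyV-suc) (from T-∨ (inj₂ (from (T-anyV (P ∘ suc)) (i , p))))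

-- Recognising the path-length distance

search-least : (f : ℕ → Bool) {d : ℕ} → (∀ k → T (f k) ⇔ d ≤ k) →
               ∀ fuel {s} → s ≤ d → d ≤ s + fuel → search f fuel s ≡ d
search-least f {d} spec zero       {s} s≤d d≤s+0 = ≤-antisym s≤d (subst (d ≤_) (+-identityʳ s) d≤s+0)
search-least f {d} spec (suc fuel) {s} s≤d d≤s+1+fuel with f s | spec s
... | true  | fs⇔d≤s = ≤-antisym s≤d (to fs⇔d≤s _)
... | false | fs⇔d≤s = search-least f spec fuel s<d (subst (d ≤_) (+-suc s fuel) d≤s+1+fuel)
  where
  s<d : suc s ≤ d
  s<d = ≤∧≢⇒< s≤d (λ s≡d → from fs⇔d≤s (≤-reflexive (sym s≡d)))

-- δ-bound matches the search bound n built into dist.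
record IsPathDistance {n} (G : Graph n) (δ : Fin n → Fin n → ℕ) : Set where
  field
    δ-refl  : ∀ x → δ x x ≡ 0
    δ-step  : ∀ x {y z} → adj G y z ≡ true → δ x z ≤ suc (δ x y)
    δ-pred  : ∀ x y → x ≢ y → ∃ λ z → adj G z y ≡ true × suc (δ x z) ≡ δ x y
    δ-bound : ∀ x y → δ x y ≤ n

module PathDistance {n} {G : Graph n} {δ : Fin n → Fin n → ℕ} (isPathDistance : IsPathDistance G δ) where
  open IsPathDistance isPathDistance

  δ≤0⇒≡ : ∀ {x y} → δ x y ≤ 0 → x ≡ y
  δ≤0⇒≡ {x} {y} δxy≤0 with x ≟ y
  ... | yes x≡y = x≡y
  ... | no  x≢y with δ-pred x y x≢y
  ...   | _ , _ , suc≡δxy with subst (_≤ 0) (sym suc≡δxy) δxy≤0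
  ...     | ()

  reach⇔δ≤ : ∀ k x y → T (reach G k x y) ⇔ δ x y ≤ k
  reach⇔δ≤ zero    x y = mk⇔ (λ t → subst (λ z → δ x z ≤ 0) (toWitness t) (≤-reflexive (δ-refl x)))
                             (fromWitness ∘ δ≤0⇒≡)
  reach⇔δ≤ (suc k) x y = mk⇔ to′ from′
    where
    to′ : T (reach G (suc k) x y) → δ x y ≤ suc k
    to′ t with to T-∨ t
    ... | inj₁ r = m≤n⇒m≤1+n (to (reach⇔δ≤ k x y) r)
    ... | inj₂ a with to (T-anyV _) a
    ...   | z , r∧a with to T-∧ r∧a
    ...     | r , z~y = ≤-trans (δ-step x (to T-≡ z~y)) (s≤s (to (reach⇔δ≤ k x z) r))

    from′ : δ x y ≤ suc k → T (reach G (suc k) x y)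
    from′ δxy≤1+k with m≤n⇒m<n∨m≡n δxy≤1+k
    ... | inj₁ (s≤s δxy≤k) = from T-∨ (inj₁ (from (reach⇔δ≤ k x y) δxy≤k))
    ... | inj₂ δxy≡1+k with x ≟ y
    ...   | yes refl with trans (sym (δ-refl x)) δxy≡1+k
    ...     | ()
    from′ _ | inj₂ δxy≡1+k | no x≢y with δ-pred x y x≢y
    ...     | z , z~y , suc≡δxy =
      from T-∨ (inj₂ (from (T-anyV _) (z , from T-∧ (from (reach⇔δ≤ k x z) δxz≤k , from T-≡ z~y))))
      where
      δxz≤k : δ x z ≤ k
      δxz≤k = ≤-reflexive (suc-injective (trans suc≡δxy δxy≡1+k))

  dist≡δ : ∀ x y → dist G x y ≡ δ x y
  dist≡δ x y = search-least _ (λ k → reach⇔δ≤ k x y) n z≤n (δ-bound x y)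

  walk-to : ∀ k x y → δ x y ≤ k → Walk G y x
  walk-to zero    x y δxy≤0   = subst (Walk G y) (sym (δ≤0⇒≡ δxy≤0)) here
  walk-to (suc k) x y δxy≤1+k with x ≟ y
  ... | yes refl = here
  ... | no  x≢y  with δ-pred x y x≢y
  ...   | z , z~y , suc≡δxy =
    step (trans (adj-sym G y z) z~y) (walk-to k x z (ℕ.s≤s⁻¹ (subst (_≤ suc k) (sym suc≡δxy) δxy≤1+k)))

  connected : Connected G
  connected x y = walk-to _ y x ≤-refl

pentagon⇒¬bipartite : ∀ {n} {G : Graph n} {a b c d e} →
  adj G a b ≡ true → adj G b c ≡ true → adj G c d ≡ true → adj G d e ≡ true → adj G e a ≡ true →
  ¬ Bipartite G
pentagon⇒¬bipartite {G = G} {a} {b} {c} {d} {e} ab bc cd de ea (colour , proper) = not-¬ refl colour-a≡not-colour-a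
  where
  flip : ∀ {x y} → adj G x y ≡ true → colour x ≡ not (colour y)
  flip x~y = ¬-not (proper _ _ x~y)

  colour-a≡not-colour-a : colour a ≡ not (colour a)
  colour-a≡not-colour-a = begin
    colour a                       ≡⟨ flip ab ⟩
    not (colour b)                 ≡⟨ cong not (flip bc) ⟩
    not (not (colour c))           ≡⟨ Bool.not-involutive _ ⟩
    colour c                       ≡⟨ flip cd ⟩
    not (colour d)                 ≡⟨ cong not (flip de) ⟩
    not (not (colour e))           ≡⟨ Bool.not-involutive _ ⟩
    colour e                       ≡⟨ flip ea ⟩
    not (colour a)                 ∎
    where open ≡-Reasoning

-- Blow-ups

adj⇒≢ : ∀ {n} (G : Graph n) {x y} → adj G x y ≡ true → x ≢ y
adj⇒≢ G {x} x~y refl with trans (sym x~y) (adj-irrefl G x)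
... | ()

blowUp : ∀ m {h} → Graph h → Graph (m * h)
blowUp m {h} H = record
  { adj    = λ x y → adj H (remainder {m} h x) (remainder {m} h y)
  ; sym    = λ x y → adj-sym H (remainder {m} h x) (remainder {m} h y)
  ; irrefl = λ x → adj-irrefl H (remainder {m} h x)
  }

-- δ̂ a b is the distance, in a blow-up of H, between distinct vertices over a and b.
record IsTwinDistance {h} (H : Graph h) (δ̂ : Fin h → Fin h → ℕ) : Set where
  field
    δ̂-twin  : ∀ a → δ̂ a a ≡ 2
    δ̂-adj   : ∀ {a b} → adj H a b ≡ true → δ̂ a b ≡ 1
    δ̂-step  : ∀ c {a b} → adj H a b ≡ true → δ̂ c b ≤ suc (δ̂ c a)
    δ̂-pred  : ∀ c b → (adj H c b ≡ true × δ̂ c b ≡ 1) ⊎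
                       ∃ λ a → adj H a b ≡ true × a ≢ c × suc (δ̂ c a) ≡ δ̂ c b
    δ̂-bound : ∀ a b → δ̂ a b ≤ h

Ŵcard : ∀ {h} → (Fin h → Fin h → ℕ) → Fin h → Fin h → ℕ
Ŵcard δ̂ a b = count (λ c → δ̂ c a <ᵇ δ̂ c b)

D̂card : ∀ {h} → (Fin h → Fin h → ℕ) → Fin h → Fin h → ℕ → ℕ → ℕ
D̂card δ̂ a b i j = count (λ c → ⌊ δ̂ a c ℕ.≟ i ⌋ ∧ ⌊ δ̂ b c ℕ.≟ j ⌋)

module BlowUp (m : ℕ) {h} (H : Graph h) where

  G : Graph (m * h)
  G = blowUp m H

  π : Fin (m * h) → Fin h
  π = remainder {m} h

  π-combine : ∀ l a → π (combine l a) ≡ a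
  π-combine l a = cong proj₂ (remQuot-combine {m} {h} l a)

  adj-combine : ∀ l {a b} → adj H a b ≡ true → adj G (combine l a) (combine l b) ≡ true
  adj-combine l {a} {b} = subst₂ (λ a′ b′ → adj H a′ b′ ≡ true) (sym (π-combine l a)) (sym (π-combine l b))

  regular : Regular H → Regular G
  regular (k , degree≡k) = m * k , λ x → trans (count-∘remainder m (adj H (π x))) (cong (m *_) (degree≡k (π x)))

  ¬bipartite : Fin m → ¬ Bipartite H → ¬ Bipartite G
  ¬bipartite l ¬bipartiteH (colour , proper) = ¬bipartiteH (colour ∘ combine l , λ a b a~b → proper _ _ (adj-combine l a~b))

  module Twin {δ̂ : Fin h → Fin h → ℕ} (isTwinDistance : IsTwinDistance H δ̂) where
    open IsTwinDistance isTwinDistance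

    opaque
      δ : Fin (m * h) → Fin (m * h) → ℕ
      δ x y = if does (x ≟ y) then 0 else δ̂ (π x) (π y)

      δ-refl : ∀ x → δ x x ≡ 0
      δ-refl x rewrite dec-true (x ≟ x) refl = refl

      δ-≢ : ∀ {x y} → x ≢ y → δ x y ≡ δ̂ (π x) (π y)
      δ-≢ {x} {y} x≢y rewrite dec-false (x ≟ y) x≢y = refl

    δ-adj : ∀ {x y} → adj G x y ≡ true → δ x y ≡ 1
    δ-adj x~y = trans (δ-≢ (adj⇒≢ G x~y)) (δ̂-adj x~y)

    isPathDistance : IsPathDistance G δ
    isPathDistance = record { δ-refl = δ-refl ; δ-step = δ-step ; δ-pred = δ-pred ; δ-bound = δ-bound }
      where
      δ-step : ∀ x {y z} → adj G y z ≡ true → δ x z ≤ suc (δ x y)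
      δ-step x {y} {z} y~z with x ≟ z | x ≟ y
      ... | yes refl | _        = subst (_≤ suc (δ x y)) (sym (δ-refl x)) z≤n
      ... | no  _    | yes refl = ≤-reflexive (trans (δ-adj y~z) (cong suc (sym (δ-refl x))))
      ... | no  x≢z  | no  x≢y  = subst₂ _≤_ (sym (δ-≢ x≢z)) (cong suc (sym (δ-≢ x≢y))) (δ̂-step (π x) y~z)

      δ-pred : ∀ x y → x ≢ y → ∃ λ z → adj G z y ≡ true × suc (δ x z) ≡ δ x y
      δ-pred x y x≢y with δ̂-pred (π x) (π y)
      ... | inj₁ (x~y , δ̂≡1) = x , x~y , trans (cong suc (δ-refl x)) (sym (trans (δ-≢ x≢y) δ̂≡1))
      ... | inj₂ (a , a~πy , a≢πx , suc≡δ̂) = z , z~y , (begin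
        suc (δ x z)             ≡⟨ cong suc (δ-≢ x≢z) ⟩
        suc (δ̂ (π x) (π z))     ≡⟨ cong (suc ∘ δ̂ (π x)) πz≡a ⟩
        suc (δ̂ (π x) a)         ≡⟨ suc≡δ̂ ⟩
        δ̂ (π x) (π y)           ≡⟨ δ-≢ x≢y ⟨
        δ x y                   ∎)
        where
        open ≡-Reasoning
        z = combine (quotient {m} h x) a

        πz≡a : π z ≡ a
        πz≡a = π-combine (quotient {m} h x) a

        z~y : adj G z y ≡ true
        z~y = subst (λ a′ → adj H a′ (π y) ≡ true) (sym πz≡a) a~πy

        x≢z : x ≢ z
        x≢z x≡z = a≢πx (trans (sym πz≡a) (cong π (sym x≡z)))

      δ-bound : ∀ x y → δ x y ≤ m * h
      δ-bound x y with x ≟ y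
      ... | yes refl = subst (_≤ m * h) (sym (δ-refl x)) z≤n
      ... | no  x≢y  = ≤-trans (≤-reflexive (δ-≢ x≢y))
                         (≤-trans (δ̂-bound _ _) (m≤n*m h m {{nonZeroIndex (quotient {m} h x)}}))

    open PathDistance isPathDistance public using (dist≡δ; connected)

    -- u and v exchange the values of "closer to u" and of its twin version; elsewhere they agree.
    Wcard-blowUp : ∀ {u v} → adj G u v ≡ true → Wcard G u v ≡ m * Ŵcard δ̂ (π u) (π v)
    Wcard-blowUp {u} {v} u~v = begin
      Wcard G u v                         ≡⟨ count-cong (λ x → cong₂ _<ᵇ_ (dist≡δ x u) (dist≡δ x v)) ⟩
      count (λ x → δ x u <ᵇ δ x v)        ≡⟨ count-cong (λ x → closer-swap x (x ≟ u) (x ≟ v)) ⟩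
      count (closer ∘ π ∘ (τ ⟨$⟩ʳ_))      ≡⟨ count-permute τ (closer ∘ π) ⟩
      count (closer ∘ π)                  ≡⟨ count-∘remainder m closer ⟩
      m * Ŵcard δ̂ (π u) (π v)             ∎
      where
      open ≡-Reasoning
      τ = transpose u v
      v~u = trans (adj-sym G v u) u~v

      closer : Fin h → Bool
      closer c = δ̂ c (π u) <ᵇ δ̂ c (π v)

      closer-swap : ∀ x → Dec (x ≡ u) → Dec (x ≡ v) → (δ x u <ᵇ δ x v) ≡ closer (π (τ ⟨$⟩ʳ x))
      closer-swap x (yes refl) _ =
        trans (cong₂ _<ᵇ_ (δ-refl u) (δ-adj u~v))
              (sym (trans (cong (closer ∘ π) (transpose-ˡ u v)) (cong₂ _<ᵇ_ (δ̂-adj v~u) (δ̂-twin (π v)))))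
      closer-swap x (no _) (yes refl) =
        trans (cong₂ _<ᵇ_ (δ-adj v~u) (δ-refl v))
              (sym (trans (cong (closer ∘ π) (transpose-ʳ u v)) (cong₂ _<ᵇ_ (δ̂-twin (π u)) (δ̂-adj u~v))))
      closer-swap x (no x≢u) (no x≢v) =
        trans (cong₂ _<ᵇ_ (δ-≢ x≢u) (δ-≢ x≢v)) (sym (cong (closer ∘ π) (transpose-≢ x≢u x≢v)))

    -- For x = u and x = v the pair (δ u x , δ v x) is (0 , 1), resp. (1 , 0), while its twin
    -- version is (2 , 1), resp. (1 , 2); excluding the value 1 makes these differences invisible.
    Dcard-blowUp : ∀ {u v} → adj G u v ≡ true → ∀ {i j} → i ≢ 1 → j ≢ 1 →
                   Dcard G u v i j ≡ m * D̂card δ̂ (π u) (π v) i j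
    Dcard-blowUp {u} {v} u~v {i} {j} i≢1 j≢1 = begin
      Dcard G u v i j                                  ≡⟨ count-cong (λ x → cong₂ at (dist≡δ u x) (dist≡δ v x)) ⟩
      count (λ x → at (δ u x) (δ v x))                 ≡⟨ count-cong (λ x → at-π x (x ≟ u) (x ≟ v)) ⟩
      count ((λ c → at (δ̂ (π u) c) (δ̂ (π v) c)) ∘ π)  ≡⟨ count-∘remainder m _ ⟩
      m * D̂card δ̂ (π u) (π v) i j                      ∎
      where
      open ≡-Reasoning
      v~u = trans (adj-sym G v u) u~v

      at : ℕ → ℕ → Bool
      at p q = ⌊ p ℕ.≟ i ⌋ ∧ ⌊ q ℕ.≟ j ⌋

      ⌊≟⌋-false : ∀ {p q} → p ≢ q → ⌊ p ℕ.≟ q ⌋ ≡ false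
      ⌊≟⌋-false {p} {q} p≢q = trans (isYes≗does (p ℕ.≟ q)) (dec-false (p ℕ.≟ q) p≢q)

      at-1 : ∀ p → at p 1 ≡ false
      at-1 p = trans (cong (⌊ p ℕ.≟ i ⌋ ∧_) (⌊≟⌋-false (j≢1 ∘ sym))) (Bool.∧-zeroʳ _)

      at-1ˡ : ∀ q → at 1 q ≡ false
      at-1ˡ q = cong (_∧ ⌊ q ℕ.≟ j ⌋) (⌊≟⌋-false (i≢1 ∘ sym))

      at-π : ∀ x → Dec (x ≡ u) → Dec (x ≡ v) → at (δ u x) (δ v x) ≡ at (δ̂ (π u) (π x)) (δ̂ (π v) (π x))
      at-π x (yes refl) _ =
        trans (cong₂ at (δ-refl u) (δ-adj v~u)) (trans (at-1 0) (sym (trans (cong₂ at (δ̂-twin (π u)) (δ̂-adj v~u)) (at-1 2))))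
      at-π x (no _) (yes refl) =
        trans (cong₂ at (δ-adj u~v) (δ-refl v)) (trans (at-1ˡ 0) (sym (trans (cong₂ at (δ̂-adj u~v) (δ̂-twin (π v))) (at-1ˡ 2))))
      at-π x (no x≢u) (no x≢v) = cong₂ at (δ-≢ (x≢u ∘ sym)) (δ-≢ (x≢v ∘ sym))

    nicelyDistanceBalanced : .{{NonZero m}} → ∀ {γ} → γ ≥ 1 →
                             (∀ a b → adj H a b ≡ true → Ŵcard δ̂ a b ≡ γ) → NicelyDistanceBalanced G
    nicelyDistanceBalanced {γ} γ≥1 Ŵ≡γ = m * γ , *-mono-≤ (>-nonZero⁻¹ m) γ≥1 , λ u v u~v → W≡ u~v , W≡ (trans (adj-sym G v u) u~v)
      where
      W≡ : ∀ {u v} → adj G u v ≡ true → Wcard G u v ≡ m * γ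
      W≡ {u} {v} u~v = trans (Wcard-blowUp u~v) (cong (m *_) (Ŵ≡γ (π u) (π v) u~v))

    ¬stronglyDistanceBalanced : Fin m → ∀ {a b} → adj H a b ≡ true → ∀ k →
      D̂card δ̂ a b (3 + k) (2 + k) ≢ D̂card δ̂ a b (2 + k) (3 + k) → ¬ StronglyDistanceBalanced G
    ¬stronglyDistanceBalanced l {a} {b} a~b k D̂≢ sdb = D̂≢ (*-cancelˡ-≡ _ _ m {{nonZeroIndex l}} (begin
      m * D̂card δ̂ a b (3 + k) (2 + k)   ≡⟨ D≡ (λ ()) (λ ()) ⟨
      Dcard G u v (3 + k) (2 + k)        ≡⟨ sdb u v u~v (3 + k) (s≤s z≤n) ⟩
      Dcard G u v (2 + k) (3 + k)        ≡⟨ D≡ (λ ()) (λ ()) ⟩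
      m * D̂card δ̂ a b (2 + k) (3 + k)   ∎))
      where
      open ≡-Reasoning
      u = combine l a
      v = combine l b
      u~v = adj-combine l a~b

      D≡ : ∀ {i j} → i ≢ 1 → j ≢ 1 → Dcard G u v i j ≡ m * D̂card δ̂ a b i j
      D≡ {i} {j} i≢1 j≢1 = trans (Dcard-blowUp u~v i≢1 j≢1) (cong₂ (λ a′ b′ → m * D̂card δ̂ a′ b′ i j) (π-combine l a) (π-combine l b))

-- The base graph

-- H lives on ℤ₃₀ and rotation by 3 is one of its automorphisms, so adjacency and δ̂ are
-- determined by the vertices 0, 1, 2: a vertex a ≡ r (mod 3) is adjacent to a + d for
-- d ∈ connection r, and δ̂ a (a + d) is entry d of twinDistanceRow r.
orbit : Fin 30 → Fin 3
orbit a = toℕ a mod 3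

offset : Fin 30 → Fin 30 → Fin 30
offset a b = (30 + toℕ b ∸ toℕ a) mod 30

connection : Fin 3 → List ℕ
connection 0F = 7 ∷ 10 ∷ 20 ∷ 23 ∷ []
connection 1F = 6 ∷ 20 ∷ 23 ∷ 24 ∷ []
connection 2F = 6 ∷ 7 ∷ 10 ∷ 24 ∷ []

twinDistanceRow : Fin 3 → Vec ℕ 30
twinDistanceRow 0F = 2 ∷ 2 ∷ 3 ∷ 2 ∷ 2 ∷ 3 ∷ 3 ∷ 1 ∷ 3 ∷ 3 ∷ 1 ∷ 3 ∷ 4 ∷ 2 ∷ 2 ∷ 4 ∷ 2 ∷ 2 ∷ 4 ∷ 3 ∷ 1 ∷ 3 ∷ 3 ∷ 1 ∷ 3 ∷ 3 ∷ 2 ∷ 2 ∷ 3 ∷ 2 ∷ []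
twinDistanceRow 1F = 2 ∷ 4 ∷ 3 ∷ 2 ∷ 3 ∷ 3 ∷ 1 ∷ 3 ∷ 3 ∷ 3 ∷ 2 ∷ 3 ∷ 2 ∷ 2 ∷ 2 ∷ 4 ∷ 2 ∷ 2 ∷ 2 ∷ 3 ∷ 1 ∷ 3 ∷ 3 ∷ 1 ∷ 1 ∷ 4 ∷ 2 ∷ 2 ∷ 4 ∷ 2 ∷ []
twinDistanceRow 2F = 2 ∷ 2 ∷ 4 ∷ 2 ∷ 2 ∷ 4 ∷ 1 ∷ 1 ∷ 3 ∷ 3 ∷ 1 ∷ 3 ∷ 2 ∷ 2 ∷ 2 ∷ 4 ∷ 2 ∷ 2 ∷ 2 ∷ 3 ∷ 2 ∷ 3 ∷ 3 ∷ 3 ∷ 1 ∷ 3 ∷ 3 ∷ 2 ∷ 3 ∷ 4 ∷ []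

adjH : Fin 30 → Fin 30 → Bool
adjH a b = ⌊ toℕ (offset a b) ∈? connection (orbit a) ⌋

H : Graph 30
H = record
  { adj    = adjH
  ; sym    = toWitness {a? = all? λ a → all? λ b → adjH a b Bool.≟ adjH b a} _
  ; irrefl = toWitness {a? = all? λ a → adjH a a Bool.≟ false} _
  }

δ̂H : Fin 30 → Fin 30 → ℕ
δ̂H a b = lookup (twinDistanceRow (orbit a)) (offset a b)

δ̂H-isTwinDistance : IsTwinDistance H δ̂H
δ̂H-isTwinDistance = record
  { δ̂-twin  = toWitness {a? = all? λ a → δ̂H a a ℕ.≟ 2} _
  ; δ̂-adj   = λ {a} {b} → adj⇒δ̂≡1 a b
  ; δ̂-step  = λ c {a} {b} → δ̂H-step c a b
  ; δ̂-pred  = toWitness {a? = all? λ c → all? λ b →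
                 ((adjH c b Bool.≟ true) ×-dec (δ̂H c b ℕ.≟ 1)) ⊎-dec
                 any? λ a → (adjH a b Bool.≟ true) ×-dec ¬? (a ≟ c) ×-dec (suc (δ̂H c a) ℕ.≟ δ̂H c b)} _
  ; δ̂-bound = toWitness {a? = all? λ a → all? λ b → δ̂H a b ℕ.≤? 30} _
  }
  where
  adj⇒δ̂≡1 : ∀ a b → adjH a b ≡ true → δ̂H a b ≡ 1
  adj⇒δ̂≡1 = toWitness {a? = all? λ a → all? λ b → (adjH a b Bool.≟ true) →-dec (δ̂H a b ℕ.≟ 1)} _

  δ̂H-step : ∀ c a b → adjH a b ≡ true → δ̂H c b ≤ suc (δ̂H c a)
  δ̂H-step = toWitness {a? = all? λ c → all? λ a → all? λ b → (adjH a b Bool.≟ true) →-dec (δ̂H c b ℕ.≤? suc (δ̂H c a))} _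

H-regular : Regular H
H-regular = 4 , toWitness {a? = all? λ a → degree H a ℕ.≟ 4} _

H-¬bipartite : ¬ Bipartite H
H-¬bipartite = pentagon⇒¬bipartite {G = H} {# 0} {# 10} {# 3} {# 13} {# 7} refl refl refl refl refl

Ŵcard-H : ∀ a b → adj H a b ≡ true → Ŵcard δ̂H a b ≡ 12
Ŵcard-H = toWitness {a? = all? λ a → all? λ b → (adjH a b Bool.≟ true) →-dec (Ŵcard δ̂H a b ℕ.≟ 12)} _

D̂card-H : D̂card δ̂H (# 0) (# 7) 3 2 ≢ D̂card δ̂H (# 0) (# 7) 2 3
D̂card-H ()

corollary3p8 : (N : ℕ) → Σ ℕ λ n → (n ≥ N) × Σ (Graph n) λ G →
    Connected G × Regular G × ¬ Bipartite G × NicelyDistanceBalanced G × ¬ StronglyDistanceBalanced G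
corollary3p8 N =
  suc N * 30 , ≤-trans (n≤1+n N) (m≤m*n (suc N) 30) ,
  G , connected , regular H-regular , ¬bipartite zero H-¬bipartite ,
  nicelyDistanceBalanced (s≤s z≤n) Ŵcard-H ,
  ¬stronglyDistanceBalanced zero {# 0} {# 7} refl 0 D̂card-H
  where
  open BlowUp (suc N) H
  open Twin δ̂H-isTwinDistance
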